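{- Let $\alpha,\beta,\gamma$ be nonnegative integers and put $q=((4\beta+3)\gamma+(3\beta+2))(\alpha+1)-(\beta+2)$. Then $4q+5$ is an Erdős–Straus number.
   Context: A positive integer $n\ge 2$ is called an Erdős–Straus number if there exist positive integers $x,y,z$ with $\frac{4}{n}=\frac1x+\frac1y+\frac1z$. -}

module Defs where

open import Data.Nat using (ℕ; _+_; _*_; _∸_; _≤_)
open import Data.Product using (Σ; _×_)
open import Relation.Binary.PropositionalEquality using (_≡_)

-- n ≥ 2 is an Erdős–Straus number iff there are positive integers x y z with
-- 4/n = 1/x + 1/y + 1/z, i.e. (clearing denominators, all positive)
-- 4 * x * y * z = n * (y * z + x * z + x * y).
ErdosStraus : ℕ → Set
ErdosStraus n =
  (2 ≤ n) ×
  Σ ℕ λ x → Σ ℕ λ y → Σ ℕ λ z →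
    (1 ≤ x) × (1 ≤ y) × (1 ≤ z) ×
    (4 * x * y * z ≡ n * (y * z + x * z + x * y))

-- q = ((4β+3)γ + (3β+2))(α+1) − (β+2); this is always ≥ 0 since
-- (3β+2)(α+1) ≥ β+2, so truncated subtraction is exact.
q : ℕ → ℕ → ℕ → ℕ
q α β γ = ((4 * β + 3) * γ + (3 * β + 2)) * (α + 1) ∸ (β + 2)

{-# OPTIONS --safe #-}
-- With a = α + 1, k = (4β+3)γ + (3β+2) and t = 4aγ + 3α + 2 we have
-- n = 4q + 5 = 4ak − (4β+3), and since 4k + 1 = (4β+3)(4γ+3) also
-- n + a = (4β+3)t.  These two relations give
-- 4/n = 1/(ak) + 1/(akt) + 1/(nkt).
module Submission where

open import Defs
open import Data.Nat using (ℕ; _+_; _*_; _∸_; _≤_; s≤s; z≤n)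
open import Data.Nat.Properties using (m+n∸m≡n; ≤-refl; ≤-trans; m≤n⇒m≤o+n; *-mono-≤)
open import Data.Nat.Tactic.RingSolver using (solve)
open import Data.List using (_∷_; [])
open import Data.Product using (_,_)
open import Relation.Binary.PropositionalEquality using (_≡_; cong; sym; module ≡-Reasoning)

unitFraction-identity : ∀ n m a k t → 4 * a * k ≡ n + m → n + a ≡ m * t →
  4 * (a * k) * (a * k * t) * (n * k * t) ≡
  n * (a * k * t * (n * k * t) + a * k * (n * k * t) + a * k * (a * k * t))
unitFraction-identity n m a k t 4ak≡n+m n+a≡mt = begin
  4 * (a * k) * (a * k * t) * (n * k * t)
    ≡⟨ solve (n ∷ a ∷ k ∷ t ∷ []) ⟩
  n * a * k * k * t * (4 * a * k * t)
    ≡⟨ cong (λ s → n * a * k * k * t * (s * t)) 4ak≡n+m ⟩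
  n * a * k * k * t * ((n + m) * t)
    ≡⟨ solve (n ∷ m ∷ a ∷ k ∷ t ∷ []) ⟩
  n * a * k * k * t * (n * t + m * t)
    ≡⟨ cong (λ s → n * a * k * k * t * (n * t + s)) (sym n+a≡mt) ⟩
  n * a * k * k * t * (n * t + (n + a))
    ≡⟨ solve (n ∷ a ∷ k ∷ t ∷ []) ⟩
  n * (a * k * t * (n * k * t) + a * k * (n * k * t) + a * k * (a * k * t))
    ∎
  where open ≡-Reasoning

erdosStraus-from : ∀ {n m a k t} → 2 ≤ n → 1 ≤ a → 1 ≤ k → 1 ≤ t →
  4 * a * k ≡ n + m → n + a ≡ m * t → ErdosStraus n
erdosStraus-from {n} {m} {a} {k} {t} 2≤n 1≤a 1≤k 1≤t 4ak≡n+m n+a≡mt =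
  2≤n , a * k , a * k * t , n * k * t ,
  1≤ak , *-mono-≤ 1≤ak 1≤t , *-mono-≤ (*-mono-≤ 1≤n 1≤k) 1≤t ,
  unitFraction-identity n m a k t 4ak≡n+m n+a≡mt
  where
  1≤ak : 1 ≤ a * k
  1≤ak = *-mono-≤ 1≤a 1≤k
  1≤n : 1 ≤ n
  1≤n = ≤-trans (s≤s z≤n) 2≤n

q-expand : ∀ α β γ → q α β γ ≡ ((4 * β + 3) * γ + (3 * β + 2)) * α + (4 * β + 3) * γ + 2 * β
q-expand α β γ = begin
  ((4 * β + 3) * γ + (3 * β + 2)) * (α + 1) ∸ (β + 2)
    ≡⟨ cong (_∸ (β + 2)) split ⟩
  (β + 2) + (((4 * β + 3) * γ + (3 * β + 2)) * α + (4 * β + 3) * γ + 2 * β) ∸ (β + 2)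
    ≡⟨ m+n∸m≡n (β + 2) _ ⟩
  ((4 * β + 3) * γ + (3 * β + 2)) * α + (4 * β + 3) * γ + 2 * β
    ∎
  where
  open ≡-Reasoning
  split : ((4 * β + 3) * γ + (3 * β + 2)) * (α + 1) ≡
          (β + 2) + (((4 * β + 3) * γ + (3 * β + 2)) * α + (4 * β + 3) * γ + 2 * β)
  split = solve (α ∷ β ∷ γ ∷ [])

4[α+1]k≡4q+5+[4β+3] : ∀ α β γ →
  4 * (α + 1) * ((4 * β + 3) * γ + (3 * β + 2)) ≡ (4 * q α β γ + 5) + (4 * β + 3)
4[α+1]k≡4q+5+[4β+3] α β γ rewrite q-expand α β γ = solve (α ∷ β ∷ γ ∷ [])

4q+5+[α+1]≡[4β+3]t : ∀ α β γ →
  (4 * q α β γ + 5) + (α + 1) ≡ (4 * β + 3) * (4 * (α + 1) * γ + 3 * α + 2)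
4q+5+[α+1]≡[4β+3]t α β γ rewrite q-expand α β γ = solve (α ∷ β ∷ γ ∷ [])

lemma2p5 : (α β γ : ℕ) → ErdosStraus (4 * q α β γ + 5)
lemma2p5 α β γ =
  erdosStraus-from
    (m≤n⇒m≤o+n (4 * q α β γ) (s≤s (s≤s z≤n)))
    (m≤n⇒m≤o+n α ≤-refl)
    (m≤n⇒m≤o+n ((4 * β + 3) * γ) (m≤n⇒m≤o+n (3 * β) (s≤s z≤n)))
    (m≤n⇒m≤o+n (4 * (α + 1) * γ + 3 * α) (s≤s z≤n))
    (4[α+1]k≡4q+5+[4β+3] α β γ)
    (4q+5+[α+1]≡[4β+3]t α β γ)
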